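{- Let $m,n,k \geq 2$, let $\mathbb{P}=m \oplus n \oplus k$ with minimal elements $A$, middle elements $B$ and maximal elements $C$, and let $f:\mathbb{P}^2 \rightarrow \mathbb{P}$ be a monotone map. Suppose $|B| > 2$, $f(B^2) \subseteq B$ and $|f(B^2)|\geq 2$. Then there exist distinct $b,b' \in B$ and automorphisms $\tau_0,\tau_1$ of $\mathbb{P}$ such that (1) $\tau_i(x)=x$ for all $x \in A \cup C$ and $i=0,1$; and (2) $(\tau_0 \circ f \circ \sigma)(s,s)=s$ for $s \in \{b,b'\}$, where $\sigma(x,y) = (\tau_1(x),y)$.
   Context: For $n\geq1$, $n$ denotes the $n$-element antichain; the ordinal sum $\mathbb{P}\oplus\mathbb{Q}$ of posets is the disjoint union with additionally $p\leq q$ for all $p\in P$, $q\in Q$. Thus $m\oplus n\oplus k$ consists of an $m$-element antichain $A$ below an $n$-element antichain $B$ below a $k$-element antichain $C$. $\mathbb{P}^2$ carries the product order. -}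

module Defs where

open import Data.Nat using (ℕ)
open import Data.Fin using (Fin)
open import Data.Product using (Σ; _×_; _,_)
open import Data.Unit using (⊤)
open import Data.Empty using (⊥)
open import Relation.Binary.PropositionalEquality using (_≡_)
open import Function.Bundles using (_⇔_)

-- The poset  m ⊕ n ⊕ k : an m-antichain A (lo) below an n-antichain B (mid)
-- below a k-antichain C (hi).
data El (m n k : ℕ) : Set where
  lo  : Fin m → El m n k
  mid : Fin n → El m n k
  hi  : Fin k → El m n k

_≤P_ : ∀ {m n k} → El m n k → El m n k → Set
lo i  ≤P lo j  = i ≡ j
lo _  ≤P mid _ = ⊤
lo _  ≤P hi _  = ⊤
mid _ ≤P lo _  = ⊥
mid i ≤P mid j = i ≡ j
mid _ ≤P hi _  = ⊤
hi _  ≤P lo _  = ⊥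
hi _  ≤P mid _ = ⊥
hi i  ≤P hi j  = i ≡ j

_≤P²_ : ∀ {m n k} → El m n k × El m n k → El m n k × El m n k → Set
(x , y) ≤P² (x' , y') = (x ≤P x') × (y ≤P y')

Monotone² : ∀ {m n k} → (El m n k × El m n k → El m n k) → Set
Monotone² f = ∀ p q → p ≤P² q → f p ≤P f q

IsAutomorphism : ∀ {m n k} → (El m n k → El m n k) → Set
IsAutomorphism {m} {n} {k} τ =
  Σ (El m n k → El m n k) λ τ⁻¹ →
    (∀ x → τ⁻¹ (τ x) ≡ x) × (∀ x → τ (τ⁻¹ x) ≡ x) ×
    (∀ x y → (x ≤P y) ⇔ (τ x ≤P τ y))

{-# OPTIONS --safe #-}
module Submission where

open import Defs
open import Data.Nat using (ℕ; _≥_; _>_; s≤s)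
open import Data.Fin using (Fin; zero; punchIn; punchOut)
open import Data.Fin.Properties
  using (_≟_; punchInᵢ≢i; punchIn-injective; punchIn-punchOut)
open import Data.Fin.Permutation
  using (Permutation′; _⟨$⟩ʳ_; _⟨$⟩ˡ_; inverseˡ; inverseʳ; flip; transpose; _∘ₚ_)
open import Data.Product using (Σ; ∃; _×_; _,_; proj₁; proj₂)
open import Data.Sum using (_⊎_; inj₁; inj₂)
open import Function.Bundles using (_⇔_; mk⇔)
open import Function.Construct.Identity using (⇔-id)
open import Relation.Binary.Definitions using (DecidableEquality)
open import Relation.Binary.PropositionalEquality
  using (_≡_; _≢_; refl; sym; trans; cong; module ≡-Reasoning)
open import Relation.Nullary using (yes; no)
open import Relation.Nullary.Decidable using (dec-true; dec-false)

-- Only the restriction g of f to B² matters.  Since |B| > 2 there is a point of B² differing in both coordinates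
-- from each of two given points with distinct g-values, and its g-value differs from
-- one of theirs.  This yields (x₀ , y₀), (x₁ , y₁) with x₀ ≢ x₁, y₀ ≢ y₁ and
-- g x₀ y₀ ≢ g x₁ y₁; since the permutation group of B is transitive on pairs of
-- distinct points, τ₁ can send yᵢ to xᵢ and τ₀ can send g xᵢ yᵢ back to yᵢ.

private
  variable
    m n k : ℕ

transpose-sendsˡ : (i j : Fin n) → transpose i j ⟨$⟩ʳ i ≡ j
transpose-sendsˡ i j rewrite dec-true (i ≟ i) refl = refl

transpose-fixes : {i j l : Fin n} → l ≢ i → l ≢ j → transpose i j ⟨$⟩ʳ l ≡ l
transpose-fixes {i = i} {j} {l} l≢i l≢j
  rewrite dec-false (l ≟ i) l≢i | dec-false (l ≟ j) l≢j = refl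

⟨$⟩ʳ-injective : (π : Permutation′ n) {i j : Fin n} → π ⟨$⟩ʳ i ≡ π ⟨$⟩ʳ j → i ≡ j
⟨$⟩ʳ-injective π {i} {j} πi≡πj = begin
  i                  ≡⟨ inverseˡ π ⟨
  π ⟨$⟩ˡ (π ⟨$⟩ʳ i)  ≡⟨ cong (π ⟨$⟩ˡ_) πi≡πj ⟩
  π ⟨$⟩ˡ (π ⟨$⟩ʳ j)  ≡⟨ inverseˡ π ⟩
  j                  ∎
  where open ≡-Reasoning

sendPair : (p q p′ q′ : Fin n) → Permutation′ n
sendPair p q p′ q′ = transpose p p′ ∘ₚ transpose (transpose p p′ ⟨$⟩ʳ q) q′

sendPair-snd : (p q p′ q′ : Fin n) → sendPair p q p′ q′ ⟨$⟩ʳ q ≡ q′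
sendPair-snd p q p′ q′ = transpose-sendsˡ (transpose p p′ ⟨$⟩ʳ q) q′

sendPair-fst : {p q p′ q′ : Fin n} → p ≢ q → p′ ≢ q′ → sendPair p q p′ q′ ⟨$⟩ʳ p ≡ p′
sendPair-fst {p = p} {q} {p′} {q′} p≢q p′≢q′
  rewrite transpose-sendsˡ p p′ = transpose-fixes p′≢r p′≢q′
  where
  p′≢r : p′ ≢ transpose p p′ ⟨$⟩ʳ q
  p′≢r p′≡r = p≢q (⟨$⟩ʳ-injective (transpose p p′) (trans (transpose-sendsˡ p p′) p′≡r))

avoid-two : n > 2 → (a b : Fin n) → ∃ λ z → z ≢ a × z ≢ b
avoid-two (s≤s (s≤s (s≤s _))) a b with a ≟ b
... | yes refl = punchIn a zero , punchInᵢ≢i a zero , punchInᵢ≢i a zero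
... | no a≢b   = punchIn a c , punchInᵢ≢i a c , z≢b
  where
  b′ c : Fin _
  b′ = punchOut a≢b
  c  = punchIn b′ zero
  z≢b : punchIn a c ≢ b
  z≢b z≡b = punchInᵢ≢i b′ zero
    (punchIn-injective a c b′ (trans z≡b (sym (punchIn-punchOut a≢b))))

record Separation {a} {A : Set a} {p q : ℕ} (g : Fin p → Fin q → A) : Set a where
  field
    x₀ x₁   : Fin p
    y₀ y₁   : Fin q
    x₀≢x₁   : x₀ ≢ x₁
    y₀≢y₁   : y₀ ≢ y₁
    g₀≢g₁   : g x₀ y₀ ≢ g x₁ y₁

separation : ∀ {a} {A : Set a} {p q : ℕ} → DecidableEquality A → p > 2 → q > 2 →
  (g : Fin p → Fin q → A) {x x′ : Fin p} {y y′ : Fin q} →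
  g x y ≢ g x′ y′ → Separation g
separation _≟A_ p>2 q>2 g {x} {x′} {y} {y′} gxy≢gx′y′
  with z , z≢x , z≢x′ ← avoid-two p>2 x x′
     | c , c≢y , c≢y′ ← avoid-two q>2 y y′
     | g x y ≟A g z c
... | no gxy≢gzc = record
  { x₀ = x ; x₁ = z ; y₀ = y ; y₁ = c
  ; x₀≢x₁ = λ x≡z → z≢x (sym x≡z) ; y₀≢y₁ = λ y≡c → c≢y (sym y≡c) ; g₀≢g₁ = gxy≢gzc }
... | yes gxy≡gzc = record
  { x₀ = x′ ; x₁ = z ; y₀ = y′ ; y₁ = c
  ; x₀≢x₁ = λ x′≡z → z≢x′ (sym x′≡z) ; y₀≢y₁ = λ y′≡c → c≢y′ (sym y′≡c)
  ; g₀≢g₁ = λ gx′y′≡gzc → gxy≢gx′y′ (trans gxy≡gzc (sym gx′y′≡gzc)) }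

liftMid : Permutation′ n → El m n k → El m n k
liftMid π (lo i)  = lo i
liftMid π (mid i) = mid (π ⟨$⟩ʳ i)
liftMid π (hi i)  = hi i

liftMid-isAutomorphism : (π : Permutation′ n) → IsAutomorphism {m} {n} {k} (liftMid π)
liftMid-isAutomorphism {n = n} {m = m} {k = k} π = liftMid (flip π) , left , right , order
  where
  left : ∀ x → liftMid (flip π) (liftMid π x) ≡ x
  left (lo i)  = refl
  left (mid i) = cong mid (inverseˡ π)
  left (hi i)  = refl
  right : ∀ x → liftMid π (liftMid (flip π) x) ≡ x
  right (lo i)  = refl
  right (mid i) = cong mid (inverseʳ π)
  right (hi i)  = refl
  order : ∀ (x y : El m n k) → (x ≤P y) ⇔ (liftMid π x ≤P liftMid π y)
  order (mid i) (mid j) = mk⇔ (cong (π ⟨$⟩ʳ_)) (⟨$⟩ʳ-injective π)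
  order (lo _)  (lo _)  = ⇔-id _
  order (lo _)  (mid _) = ⇔-id _
  order (lo _)  (hi _)  = ⇔-id _
  order (mid _) (lo _)  = ⇔-id _
  order (mid _) (hi _)  = ⇔-id _
  order (hi _)  (lo _)  = ⇔-id _
  order (hi _)  (mid _) = ⇔-id _
  order (hi _)  (hi _)  = ⇔-id _

module _ (f : El m n k × El m n k → El m n k)
         (f-mid : ∀ b b′ → Σ (Fin n) λ c → f (mid b , mid b′) ≡ mid c) where
  open ≡-Reasoning

  restrictMid : Fin n → Fin n → Fin n
  restrictMid b b′ = proj₁ (f-mid b b′)

  restrictMid-≢ : {b₁ b₂ b₃ b₄ : Fin n} → f (mid b₁ , mid b₂) ≢ f (mid b₃ , mid b₄) →
    restrictMid b₁ b₂ ≢ restrictMid b₃ b₄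
  restrictMid-≢ {b₁} {b₂} {b₃} {b₄} f₁₂≢f₃₄ g₁₂≡g₃₄ = f₁₂≢f₃₄ (begin
    f (mid b₁ , mid b₂)       ≡⟨ proj₂ (f-mid b₁ b₂) ⟩
    mid (restrictMid b₁ b₂)   ≡⟨ cong mid g₁₂≡g₃₄ ⟩
    mid (restrictMid b₃ b₄)   ≡⟨ proj₂ (f-mid b₃ b₄) ⟨
    f (mid b₃ , mid b₄)       ∎)

  liftMid-conjugate-fixes : (π₀ π₁ : Permutation′ n) {x y : Fin n} →
    π₁ ⟨$⟩ʳ y ≡ x → π₀ ⟨$⟩ʳ restrictMid x y ≡ y →
    liftMid π₀ (f (liftMid π₁ (mid y) , mid y)) ≡ mid y
  liftMid-conjugate-fixes π₀ π₁ {x} {y} π₁y≡x π₀gxy≡y = begin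
    liftMid π₀ (f (mid (π₁ ⟨$⟩ʳ y) , mid y))  ≡⟨ cong (λ x′ → liftMid π₀ (f (mid x′ , mid y))) π₁y≡x ⟩
    liftMid π₀ (f (mid x , mid y))            ≡⟨ cong (liftMid π₀) (proj₂ (f-mid x y)) ⟩
    mid (π₀ ⟨$⟩ʳ restrictMid x y)             ≡⟨ cong mid π₀gxy≡y ⟩
    mid y                                     ∎

lemma5p3 : (m n k : ℕ) → m ≥ 2 → n ≥ 2 → k ≥ 2 →
    (f : El m n k × El m n k → El m n k) → Monotone² f →
    n > 2 →
    (∀ b b' → Σ (Fin n) λ c → f (mid b , mid b') ≡ mid c) →
    (Σ (Fin n) λ b₁ → Σ (Fin n) λ b₂ → Σ (Fin n) λ b₃ → Σ (Fin n) λ b₄ →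
      f (mid b₁ , mid b₂) ≢ f (mid b₃ , mid b₄)) →
    Σ (Fin n) λ b → Σ (Fin n) λ b' → b ≢ b' ×
      (Σ (El m n k → El m n k) λ τ₀ → Σ (El m n k → El m n k) λ τ₁ →
        IsAutomorphism τ₀ × IsAutomorphism τ₁ ×
        (∀ i → τ₀ (lo i) ≡ lo i) × (∀ i → τ₀ (hi i) ≡ hi i) ×
        (∀ i → τ₁ (lo i) ≡ lo i) × (∀ i → τ₁ (hi i) ≡ hi i) ×
        (∀ s → (s ≡ mid b) ⊎ (s ≡ mid b') →
          τ₀ (f (τ₁ s , s)) ≡ s))
lemma5p3 m n k _ _ _ f _ n>2 f-mid (b₁ , b₂ , b₃ , b₄ , f₁₂≢f₃₄) =
  y₀ , y₁ , y₀≢y₁ , liftMid π₀ , liftMid π₁ ,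
  liftMid-isAutomorphism π₀ , liftMid-isAutomorphism π₁ ,
  (λ _ → refl) , (λ _ → refl) , (λ _ → refl) , (λ _ → refl) , fixes
  where
  g : Fin n → Fin n → Fin n
  g = restrictMid f f-mid

  open Separation (separation _≟_ n>2 n>2 g (restrictMid-≢ f f-mid f₁₂≢f₃₄))

  π₀ π₁ : Permutation′ n
  π₀ = sendPair (g x₀ y₀) (g x₁ y₁) y₀ y₁
  π₁ = sendPair y₀ y₁ x₀ x₁

  fixes : ∀ s → (s ≡ mid y₀) ⊎ (s ≡ mid y₁) → liftMid π₀ (f (liftMid π₁ s , s)) ≡ s
  fixes _ (inj₁ refl) = liftMid-conjugate-fixes f f-mid π₀ π₁
    (sendPair-fst y₀≢y₁ x₀≢x₁) (sendPair-fst g₀≢g₁ y₀≢y₁)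
  fixes _ (inj₂ refl) = liftMid-conjugate-fixes f f-mid π₀ π₁
    (sendPair-snd y₀ y₁ x₀ x₁) (sendPair-snd (g x₀ y₀) (g x₁ y₁) y₀ y₁)
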